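{- Let $\alpha$ be a composition of $n$. Then \[\frac{n!}{\pi(\alpha^{\mathrm{rev}})}=\sum_{\beta\succeq\alpha}(-1)^{l(\alpha)-l(\beta)}\frac{n!}{\pi(\alpha,\beta)},\] where the sum is over all compositions $\beta$ coarsening $\alpha$.
   Context: For a composition $\alpha=(\alpha_1,\dots,\alpha_l)$, $l(\alpha)=l$, $\alpha^{\mathrm{rev}}$ is its reversal, and $\pi(\alpha)=\prod_{i=1}^{l}(\alpha_1+\cdots+\alpha_i)$. $\beta\succeq\alpha$ ($\beta$ coarsens $\alpha$) means $\beta$ is obtained by summing consecutive blocks of parts of $\alpha$; then $\alpha^{(i)}$ denotes the composition of the parts of $\alpha$ that sum to $\beta_i$, and $\pi(\alpha,\beta)=\prod_{i=1}^{l(\beta)}\pi(\alpha^{(i)})$. -}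

module Defs where

open import Data.Nat as ℕ using (ℕ; zero; suc; _∸_; _<_; _!)
open import Data.Integer using (+_)
open import Data.List using (List; []; _∷_; [_]; length; map; concatMap; foldr)
open import Data.Nat.ListAction using (sum; product)
open import Data.Product using (_×_)
open import Relation.Binary.PropositionalEquality using (_≡_)
open import Data.List.Relation.Unary.All using (All)
open import Data.Rational using (ℚ; 0ℚ; 1ℚ; -_; _/_) renaming (_+_ to _+ℚ_; _*_ to _*ℚ_)

IsComposition : ℕ → List ℕ → Set
IsComposition n α = All (0 <_) α × sum α ≡ n

partialSums : List ℕ → List ℕ
partialSums []       = []
partialSums (a ∷ as) = a ∷ map (a ℕ.+_) (partialSums as)

π : List ℕ → ℕ
π α = product (partialSums α)

-- All ways to cut α into consecutive nonempty blocks (α⁽¹⁾, …, α⁽ᵏ⁾).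
-- These are in bijection with the coarsenings β ⪰ α (β = map sum blocks),
-- since the parts of α are positive.
blockings : List ℕ → List (List (List ℕ))
blockings []       = [ [] ]
blockings (a ∷ as) = concatMap extend (blockings as)
  where
    extend : List (List ℕ) → List (List (List ℕ))
    extend []       = [ [ a ] ∷ [] ]
    extend (b ∷ bs) = ([ a ] ∷ b ∷ bs) ∷ ((a ∷ b) ∷ bs) ∷ []

coarsening : List (List ℕ) → List ℕ
coarsening = map sum

π₂ : List (List ℕ) → ℕ
π₂ bs = product (map π bs)

-- m / d as a rational (d = 0 never occurs in the statement; set to 0 then)
frac : ℕ → ℕ → ℚ
frac m zero    = 0ℚ
frac m (suc d) = (+ m) / suc d

sign : ℕ → ℚ
sign zero    = 1ℚ
sign (suc k) = - sign k

sumℚ : List ℚ → ℚ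
sumℚ = foldr _+ℚ_ 0ℚ

term : ℕ → List ℕ → List (List ℕ) → ℚ
term n α bs = sign (length α ∸ length (coarsening bs)) *ℚ frac (n !) (π₂ bs)

-- Dividing by n!, the right-hand side is a signed sum of 1/π(α,β) over the blockings of α.
-- Generalise it to weightSum c α, in which the partial sums of the first block are shifted
-- by c. A blocking of a ∷ α′ is a blocking of α′ with a either put in a new block in front
-- or merged into the first block (which shifts that block by a), so for α′ nonempty
--   weightSum c (a ∷ α′) = 1/(c+a) · (weightSum 0 α′ − weightSum (c+a) α′).
-- With the partial fraction identity 1/u · (1/v − 1/(u+v)) = 1/((u+v) v) this gives, by
-- induction, weightSum c (a ∷ α′) = 1/(c + a + sum α′) · 1/π(α′ʳᵉᵛ), i.e. 1/π(αʳᵉᵛ) at c = 0.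

module Submission where

open import Data.Nat as ℕ using (ℕ; zero; suc; _!; _≤_; _<_; s≤s; z≤n)
import Data.Nat.Properties as ℕ
open import Data.Nat.ListAction using (sum; product)
open import Data.Nat.ListAction.Properties using (sum-↭; product-++)
import Data.Integer as ℤ
import Data.Integer.Properties as ℤ
open import Data.Rational using (ℚ; _+_; _*_; -_; _-_; 0ℚ; 1ℚ; fromℚᵘ)
open import Data.Rational.Properties
import Data.Rational.Unnormalised as ℚᵘ
import Data.Rational.Unnormalised.Properties as ℚᵘ
import Data.Rational.Solver as ℚSolver
open import Data.List using (List; []; _∷_; [_]; length; map; concatMap; concat; reverse; _++_)
open import Data.List.Properties using (map-++; map-cong; map-cong-local; map-∘; map-id; length-map; unfold-reverse)
open import Data.List.Relation.Unary.All as All using (All; []; _∷_)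
open import Data.List.Relation.Unary.All.Properties using (concat⁺; map⁺)
open import Data.List.Relation.Binary.Permutation.Propositional.Properties using (↭-reverse)
open import Data.Product using (_,_)
open import Function using (_∘_)
open import Relation.Binary.PropositionalEquality using (_≡_; refl; sym; trans; cong; cong₂; module ≡-Reasoning)
open import Defs

open ℚSolver.+-*-Solver

fromℚᵘ-homo-+ : ∀ p q → fromℚᵘ (p ℚᵘ.+ q) ≡ fromℚᵘ p + fromℚᵘ q
fromℚᵘ-homo-+ p q = trans
  (fromℚᵘ-cong (ℚᵘ.+-cong (ℚᵘ.≃-sym (toℚᵘ-fromℚᵘ p)) (ℚᵘ.≃-sym (toℚᵘ-fromℚᵘ q))))
  (trans (fromℚᵘ-cong (ℚᵘ.≃-sym (toℚᵘ-homo-+ (fromℚᵘ p) (fromℚᵘ q)))) (fromℚᵘ-toℚᵘ _))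

fromℚᵘ-homo-* : ∀ p q → fromℚᵘ (p ℚᵘ.* q) ≡ fromℚᵘ p * fromℚᵘ q
fromℚᵘ-homo-* p q = trans
  (fromℚᵘ-cong (ℚᵘ.*-cong (ℚᵘ.≃-sym (toℚᵘ-fromℚᵘ p)) (ℚᵘ.≃-sym (toℚᵘ-fromℚᵘ q))))
  (trans (fromℚᵘ-cong (ℚᵘ.≃-sym (toℚᵘ-homo-* (fromℚᵘ p) (fromℚᵘ q)))) (fromℚᵘ-toℚᵘ _))

ιᵘ : ℕ → ℚᵘ.ℚᵘ
ιᵘ m = ℚᵘ.mkℚᵘ (ℤ.+ m) 0

ι : ℕ → ℚ
ι = fromℚᵘ ∘ ιᵘ

inv : ℕ → ℚ
inv = frac 1

ιᵘ-+ : ∀ a b → ιᵘ (a ℕ.+ b) ℚᵘ.≃ ιᵘ a ℚᵘ.+ ιᵘ b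
ιᵘ-+ a b = ℚᵘ.*≡* (cong (ℤ._* ℤ.+ 1) (trans (ℤ.pos-+ a b)
  (sym (cong₂ ℤ._+_ (ℤ.*-identityʳ (ℤ.+ a)) (ℤ.*-identityʳ (ℤ.+ b))))))

ιᵘ-* : ∀ a b → ιᵘ (a ℕ.* b) ℚᵘ.≃ ιᵘ a ℚᵘ.* ιᵘ b
ιᵘ-* a b = ℚᵘ.*≡* (cong (ℤ._* ℤ.+ 1) (ℤ.pos-* a b))

ι-+ : ∀ a b → ι (a ℕ.+ b) ≡ ι a + ι b
ι-+ a b = trans (fromℚᵘ-cong (ιᵘ-+ a b)) (fromℚᵘ-homo-+ (ιᵘ a) (ιᵘ b))

ι-* : ∀ a b → ι (a ℕ.* b) ≡ ι a * ι b
ι-* a b = trans (fromℚᵘ-cong (ιᵘ-* a b)) (fromℚᵘ-homo-* (ιᵘ a) (ιᵘ b))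

frac-*-ι : ∀ m d → frac m (suc d) * ι (suc d) ≡ ι m
frac-*-ι m d = trans (sym (fromℚᵘ-homo-* m/d (ιᵘ (suc d))))
  (fromℚᵘ-cong (ℚᵘ.*≡* {m/d ℚᵘ.* ιᵘ (suc d)} {ιᵘ m} (ℤ.*-assoc (ℤ.+ m) (ℤ.+ suc d) (ℤ.+ 1))))
  where
    m/d = ℚᵘ.mkℚᵘ (ℤ.+ m) d

inv-*-ι : ∀ d → inv (suc d) * ι (suc d) ≡ 1ℚ
inv-*-ι = frac-*-ι 1

*-cancelʳ-ι : ∀ d {x y} → x * ι (suc d) ≡ y * ι (suc d) → x ≡ y
*-cancelʳ-ι d {x} {y} xι≡yι = begin
  x                                ≡⟨ expand x ⟩
  (x * ι (suc d)) * inv (suc d)    ≡⟨ cong (_* inv (suc d)) xι≡yι ⟩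
  (y * ι (suc d)) * inv (suc d)    ≡⟨ sym (expand y) ⟩
  y                                ∎
  where
    open ≡-Reasoning
    expand : ∀ z → z ≡ (z * ι (suc d)) * inv (suc d)
    expand z = begin
      z                                ≡⟨ sym (*-identityʳ z) ⟩
      z * 1ℚ                           ≡⟨ cong (z *_) (sym (inv-*-ι d)) ⟩
      z * (inv (suc d) * ι (suc d))    ≡⟨ solve 3 (λ x y w → x :* (y :* w) := (x :* w) :* y) refl z (inv (suc d)) (ι (suc d)) ⟩
      (z * ι (suc d)) * inv (suc d)    ∎

frac≡ι*inv : ∀ m d → frac m d ≡ ι m * inv d
frac≡ι*inv m zero    = sym (*-zeroʳ (ι m))
frac≡ι*inv m (suc d) = *-cancelʳ-ι d (begin
  frac m (suc d) * ι (suc d)        ≡⟨ frac-*-ι m d ⟩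
  ι m                               ≡⟨ sym (*-identityʳ (ι m)) ⟩
  ι m * 1ℚ                          ≡⟨ cong (ι m *_) (sym (inv-*-ι d)) ⟩
  ι m * (inv (suc d) * ι (suc d))   ≡⟨ sym (*-assoc (ι m) _ _) ⟩
  ι m * inv (suc d) * ι (suc d)     ∎)
  where open ≡-Reasoning

inv-* : ∀ d e → inv (d ℕ.* e) ≡ inv d * inv e
inv-* zero    e       = sym (*-zeroˡ (inv e))
inv-* (suc d) zero    = trans (cong inv (ℕ.*-zeroʳ d)) (sym (*-zeroʳ (inv (suc d))))
inv-* (suc d) (suc e) = *-cancelʳ-ι (e ℕ.+ d ℕ.* suc e) (begin
  inv (suc d ℕ.* suc e) * ι (suc d ℕ.* suc e)
    ≡⟨ inv-*-ι (e ℕ.+ d ℕ.* suc e) ⟩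
  1ℚ
    ≡⟨ sym (cong₂ _*_ (inv-*-ι d) (inv-*-ι e)) ⟩
  (inv (suc d) * ι (suc d)) * (inv (suc e) * ι (suc e))
    ≡⟨ solve 4 (λ x y z w → (x :* y) :* (z :* w) := (x :* z) :* (y :* w)) refl (inv (suc d)) (ι (suc d)) (inv (suc e)) (ι (suc e)) ⟩
  (inv (suc d) * inv (suc e)) * (ι (suc d) * ι (suc e))
    ≡⟨ cong (inv (suc d) * inv (suc e) *_) (sym (ι-* (suc d) (suc e))) ⟩
  (inv (suc d) * inv (suc e)) * ι (suc d ℕ.* suc e)
    ∎)
  where open ≡-Reasoning

inv-partialFraction : ∀ u v → 0 < u → 0 < v → inv u * (inv v - inv (u ℕ.+ v)) ≡ inv (u ℕ.+ v) * inv v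
inv-partialFraction (suc u) (suc v) _ _ = begin
  inv U * (inv V - inv W)
    ≡⟨ cong₂ (λ p q → inv U * (p - q)) (sym (*-identityʳ (inv V))) (sym (*-identityʳ (inv W))) ⟩
  inv U * (inv V * 1ℚ - inv W * 1ℚ)
    ≡⟨ cong₂ (λ p q → inv U * (inv V * p - inv W * q)) (sym invW*ι) (sym (inv-*-ι v)) ⟩
  inv U * (inv V * (inv W * (ι U + ι V)) - inv W * (inv V * ι V))
    ≡⟨ solve 5 (λ x y z a b → x :* (y :* (z :* (a :+ b)) :- z :* (y :* b)) := (z :* y) :* (x :* a)) refl (inv U) (inv V) (inv W) (ι U) (ι V) ⟩
  (inv W * inv V) * (inv U * ι U)
    ≡⟨ trans (cong (inv W * inv V *_) (inv-*-ι u)) (*-identityʳ _) ⟩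
  inv W * inv V
    ∎
  where
    open ≡-Reasoning
    U V W : ℕ
    U = suc u
    V = suc v
    W = U ℕ.+ V
    invW*ι : inv W * (ι U + ι V) ≡ 1ℚ
    invW*ι = trans (cong (inv W *_) (sym (ι-+ U V))) (inv-*-ι (u ℕ.+ V))

sign-suc-∸ : ∀ {m k} → k ≤ m → sign (suc m ℕ.∸ k) ≡ - sign (m ℕ.∸ k)
sign-suc-∸ {m} k≤m = cong sign (ℕ.+-∸-assoc 1 k≤m)

sumℚ-++ : ∀ xs ys → sumℚ (xs ++ ys) ≡ sumℚ xs + sumℚ ys
sumℚ-++ []       ys = sym (+-identityˡ _)
sumℚ-++ (x ∷ xs) ys = trans (cong (x +_) (sumℚ-++ xs ys)) (sym (+-assoc x _ _))

sumℚ-map-concatMap : ∀ {A B : Set} (h : B → ℚ) (f : A → List B) xs →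
  sumℚ (map h (concatMap f xs)) ≡ sumℚ (map (λ x → sumℚ (map h (f x))) xs)
sumℚ-map-concatMap h f []       = refl
sumℚ-map-concatMap h f (x ∷ xs) = begin
  sumℚ (map h (f x ++ concatMap f xs))                   ≡⟨ cong sumℚ (map-++ h (f x) _) ⟩
  sumℚ (map h (f x) ++ map h (concatMap f xs))           ≡⟨ sumℚ-++ (map h (f x)) _ ⟩
  sumℚ (map h (f x)) + sumℚ (map h (concatMap f xs))     ≡⟨ cong (sumℚ (map h (f x)) +_) (sumℚ-map-concatMap h f xs) ⟩
  sumℚ (map h (f x)) + sumℚ (map (λ y → sumℚ (map h (f y))) xs) ∎
  where open ≡-Reasoning

sumℚ-map-*ˡ : ∀ {A : Set} k (f : A → ℚ) xs → sumℚ (map (λ x → k * f x) xs) ≡ k * sumℚ (map f xs)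
sumℚ-map-*ˡ k f []       = sym (*-zeroʳ k)
sumℚ-map-*ˡ k f (x ∷ xs) = trans (cong (k * f x +_) (sumℚ-map-*ˡ k f xs)) (sym (*-distribˡ-+ k (f x) _))

sumℚ-map-- : ∀ {A : Set} (f g : A → ℚ) xs → sumℚ (map (λ x → f x - g x) xs) ≡ sumℚ (map f xs) - sumℚ (map g xs)
sumℚ-map-- f g []       = refl
sumℚ-map-- f g (x ∷ xs) = trans (cong (f x - g x +_) (sumℚ-map-- f g xs))
  (solve 4 (λ a b c d → (a :- b) :+ (c :- d) := (a :+ c) :- (b :+ d)) refl (f x) (g x) (sumℚ (map f xs)) (sumℚ (map g xs)))

πrev : List ℕ → ℕ
πrev []       = 1
πrev (a ∷ as) = (a ℕ.+ sum as) ℕ.* πrev as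

partialSums-∷ʳ : ∀ xs a → partialSums (xs ++ [ a ]) ≡ partialSums xs ++ [ sum xs ℕ.+ a ]
partialSums-∷ʳ []       a = refl
partialSums-∷ʳ (x ∷ xs) a = cong (x ∷_) (begin
  map (x ℕ.+_) (partialSums (xs ++ [ a ]))                       ≡⟨ cong (map (x ℕ.+_)) (partialSums-∷ʳ xs a) ⟩
  map (x ℕ.+_) (partialSums xs ++ [ sum xs ℕ.+ a ])              ≡⟨ map-++ (x ℕ.+_) (partialSums xs) _ ⟩
  map (x ℕ.+_) (partialSums xs) ++ [ x ℕ.+ (sum xs ℕ.+ a) ]      ≡⟨ cong (λ s → map (x ℕ.+_) (partialSums xs) ++ [ s ]) (sym (ℕ.+-assoc x (sum xs) a)) ⟩
  map (x ℕ.+_) (partialSums xs) ++ [ x ℕ.+ sum xs ℕ.+ a ]        ∎)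
  where open ≡-Reasoning

π-reverse : ∀ α → π (reverse α) ≡ πrev α
π-reverse []       = refl
π-reverse (a ∷ as) = begin
  π (reverse (a ∷ as))                                        ≡⟨ cong π (unfold-reverse a as) ⟩
  product (partialSums (reverse as ++ [ a ]))                 ≡⟨ cong product (partialSums-∷ʳ (reverse as) a) ⟩
  product (partialSums (reverse as) ++ [ sum (reverse as) ℕ.+ a ])
                                                              ≡⟨ product-++ (partialSums (reverse as)) _ ⟩
  π (reverse as) ℕ.* ((sum (reverse as) ℕ.+ a) ℕ.* 1)         ≡⟨ cong₂ ℕ._*_ (π-reverse as) (ℕ.*-identityʳ _) ⟩
  πrev as ℕ.* (sum (reverse as) ℕ.+ a)                        ≡⟨ cong (λ s → πrev as ℕ.* (s ℕ.+ a)) (sum-↭ (↭-reverse as)) ⟩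
  πrev as ℕ.* (sum as ℕ.+ a)                                  ≡⟨ ℕ.*-comm (πrev as) _ ⟩
  (sum as ℕ.+ a) ℕ.* πrev as                                  ≡⟨ cong (ℕ._* πrev as) (ℕ.+-comm (sum as) a) ⟩
  πrev (a ∷ as)                                               ∎
  where open ≡-Reasoning

-- The where-bound helper of blockings, restated because it is not exported.
extend : ℕ → List (List ℕ) → List (List (List ℕ))
extend a []       = [ [ a ] ∷ [] ]
extend a (b ∷ bs) = ([ a ] ∷ b ∷ bs) ∷ ((a ∷ b) ∷ bs) ∷ []

blockings-∷ : ∀ a as → blockings (a ∷ as) ≡ concatMap (extend a) (blockings as)
blockings-∷ a as = cong concat (map-cong (λ { [] → refl ; (b ∷ bs) → refl }) (blockings as))

blockings-length≤ : ∀ α → All (λ bs → length bs ≤ length α) (blockings α)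
blockings-length≤ []       = z≤n ∷ []
blockings-length≤ (a ∷ as) rewrite blockings-∷ a as =
  concat⁺ (map⁺ (All.map extend-length≤ (blockings-length≤ as)))
  where
    extend-length≤ : ∀ {bs} → length bs ≤ length as → All (λ cs → length cs ≤ suc (length as)) (extend a bs)
    extend-length≤ {[]}     _     = s≤s z≤n ∷ []
    extend-length≤ {b ∷ bs} len≤ = s≤s len≤ ∷ ℕ.m≤n⇒m≤1+n len≤ ∷ []

blockings-nonempty : ∀ a as → All (λ bs → 0 < length bs) (blockings (a ∷ as))
blockings-nonempty a as rewrite blockings-∷ a as =
  concat⁺ (map⁺ (All.universal extend-nonempty (blockings as)))
  where
    extend-nonempty : ∀ bs → All (λ cs → 0 < length cs) (extend a bs)
    extend-nonempty []       = s≤s z≤n ∷ []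
    extend-nonempty (b ∷ bs) = s≤s z≤n ∷ s≤s z≤n ∷ []

πFrom : ℕ → List ℕ → ℕ
πFrom c b = product (map (c ℕ.+_) (partialSums b))

πFrom-zero : ∀ b → πFrom 0 b ≡ π b
πFrom-zero b = cong product (map-id (partialSums b))

πFrom-∷ : ∀ c a b → πFrom c (a ∷ b) ≡ (c ℕ.+ a) ℕ.* πFrom (c ℕ.+ a) b
πFrom-∷ c a b = cong (λ ps → (c ℕ.+ a) ℕ.* product ps)
  (trans (sym (map-∘ (partialSums b))) (map-cong (sym ∘ ℕ.+-assoc c a) (partialSums b)))

π₂From : ℕ → List (List ℕ) → ℕ
π₂From c []       = 1
π₂From c (b ∷ bs) = πFrom c b ℕ.* π₂ bs

π₂From-zero : ∀ bs → π₂From 0 bs ≡ π₂ bs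
π₂From-zero []       = refl
π₂From-zero (b ∷ bs) = cong (ℕ._* π₂ bs) (πFrom-zero b)

-- c shifts the partial sums of the first block; m is the number of parts being coarsened.
weight : ℕ → ℕ → List (List ℕ) → ℚ
weight c m bs = sign (m ℕ.∸ length bs) * inv (π₂From c bs)

weightSum : ℕ → List ℕ → ℚ
weightSum c α = sumℚ (map (weight c (length α)) (blockings α))

sumℚ-weight-extend : ∀ c a {m} bs → 0 < length bs → length bs ≤ m →
  sumℚ (map (weight c (suc m)) (extend a bs)) ≡ inv (c ℕ.+ a) * (weight 0 m bs - weight (c ℕ.+ a) m bs)
-- [ a ] ∷ bs contributes weight 0 m bs / (c+a); merging a into the first block of bs loses
-- one block (opposite sign) and shifts that block by c+a, contributing - weight (c+a) m bs / (c+a).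
sumℚ-weight-extend c a {m} (b ∷ bs) _ len≤m
  rewrite sign-suc-∸ len≤m | ℕ.*-identityʳ (c ℕ.+ a) | πFrom-∷ c a b | πFrom-zero b
        | inv-* (c ℕ.+ a) (π b ℕ.* π₂ bs) | inv-* ((c ℕ.+ a) ℕ.* πFrom (c ℕ.+ a) b) (π₂ bs)
        | inv-* (c ℕ.+ a) (πFrom (c ℕ.+ a) b) | inv-* (π b) (π₂ bs) | inv-* (πFrom (c ℕ.+ a) b) (π₂ bs)
  = solve 5 (λ s d p q r → s :* (d :* (q :* r)) :+ ((:- s) :* ((d :* p) :* r) :+ con 0ℚ)
                            := d :* (s :* (q :* r) :- s :* (p :* r)))
      refl (sign (m ℕ.∸ suc (length bs))) (inv (c ℕ.+ a)) (inv (πFrom (c ℕ.+ a) b)) (inv (π b)) (inv (π₂ bs))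

weightSum-∷-∷ : ∀ c a a′ as →
  weightSum c (a ∷ a′ ∷ as) ≡ inv (c ℕ.+ a) * (weightSum 0 (a′ ∷ as) - weightSum (c ℕ.+ a) (a′ ∷ as))
weightSum-∷-∷ c a a′ as = begin
  sumℚ (map (weight c (suc m)) (blockings (a ∷ a′ ∷ as)))
    ≡⟨ cong (sumℚ ∘ map (weight c (suc m))) (blockings-∷ a (a′ ∷ as)) ⟩
  sumℚ (map (weight c (suc m)) (concatMap (extend a) L))
    ≡⟨ sumℚ-map-concatMap (weight c (suc m)) (extend a) L ⟩
  sumℚ (map (λ bs → sumℚ (map (weight c (suc m)) (extend a bs))) L)
    ≡⟨ cong sumℚ (map-cong-local (All.zipWith (λ {bs} (len>0 , len≤m) → sumℚ-weight-extend c a bs len>0 len≤m)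
                                                (blockings-nonempty a′ as , blockings-length≤ (a′ ∷ as)))) ⟩
  sumℚ (map (λ bs → inv (c ℕ.+ a) * (weight 0 m bs - weight (c ℕ.+ a) m bs)) L)
    ≡⟨ sumℚ-map-*ˡ (inv (c ℕ.+ a)) _ L ⟩
  inv (c ℕ.+ a) * sumℚ (map (λ bs → weight 0 m bs - weight (c ℕ.+ a) m bs) L)
    ≡⟨ cong (inv (c ℕ.+ a) *_) (sumℚ-map-- (weight 0 m) (weight (c ℕ.+ a) m) L) ⟩
  inv (c ℕ.+ a) * (weightSum 0 (a′ ∷ as) - weightSum (c ℕ.+ a) (a′ ∷ as))
    ∎
  where
    open ≡-Reasoning
    m = length (a′ ∷ as)
    L = blockings (a′ ∷ as)

weightSum-∷ : ∀ c a as → All (0 <_) (a ∷ as) → weightSum c (a ∷ as) ≡ inv (c ℕ.+ (a ℕ.+ sum as)) * inv (πrev as)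
weightSum-∷ c a [] _ rewrite ℕ.*-identityʳ (c ℕ.+ a) | ℕ.*-identityʳ (c ℕ.+ a) | ℕ.+-identityʳ a =
  solve 1 (λ x → con 1ℚ :* x :+ con 0ℚ := x :* con 1ℚ) refl (inv (c ℕ.+ a))
weightSum-∷ c a (a′ ∷ as) (a>0 ∷ as>0@(a′>0 ∷ _)) = begin
  weightSum c (a ∷ a′ ∷ as)
    ≡⟨ weightSum-∷-∷ c a a′ as ⟩
  inv c+a * (weightSum 0 (a′ ∷ as) - weightSum c+a (a′ ∷ as))
    ≡⟨ cong₂ (λ p q → inv c+a * (p - q)) (weightSum-∷ 0 a′ as as>0) (weightSum-∷ c+a a′ as as>0) ⟩
  inv c+a * (inv S * inv Q - inv (c+a ℕ.+ S) * inv Q)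
    ≡⟨ solve 4 (λ d x y q → d :* (x :* q :- y :* q) := (d :* (x :- y)) :* q) refl (inv c+a) (inv S) (inv (c+a ℕ.+ S)) (inv Q) ⟩
  (inv c+a * (inv S - inv (c+a ℕ.+ S))) * inv Q
    ≡⟨ cong (_* inv Q) (inv-partialFraction c+a S (ℕ.<-≤-trans a>0 (ℕ.m≤n+m a c)) (ℕ.<-≤-trans a′>0 (ℕ.m≤m+n a′ (sum as)))) ⟩
  (inv (c+a ℕ.+ S) * inv S) * inv Q
    ≡⟨ cong (λ k → (inv k * inv S) * inv Q) (ℕ.+-assoc c a S) ⟩
  (inv (c ℕ.+ (a ℕ.+ S)) * inv S) * inv Q
    ≡⟨ trans (*-assoc (inv (c ℕ.+ (a ℕ.+ S))) (inv S) (inv Q)) (cong (inv (c ℕ.+ (a ℕ.+ S)) *_) (sym (inv-* S Q))) ⟩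
  inv (c ℕ.+ (a ℕ.+ S)) * inv (πrev (a′ ∷ as))
    ∎
  where
    open ≡-Reasoning
    c+a = c ℕ.+ a
    S = a′ ℕ.+ sum as
    Q = πrev as

weightSum-zero : ∀ {α} → All (0 <_) α → weightSum 0 α ≡ inv (πrev α)
weightSum-zero []               = refl
weightSum-zero {a ∷ as} parts>0 = trans (weightSum-∷ 0 a as parts>0) (sym (inv-* (a ℕ.+ sum as) (πrev as)))

term≡ι!*weight : ∀ n α bs → term n α bs ≡ ι (n !) * weight 0 (length α) bs
term≡ι!*weight n α bs = begin
  sign (length α ℕ.∸ length (coarsening bs)) * frac (n !) (π₂ bs)
    ≡⟨ cong₂ (λ k q → sign (length α ℕ.∸ k) * q) (length-map sum bs) (frac≡ι*inv (n !) (π₂ bs)) ⟩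
  s * (ι (n !) * inv (π₂ bs))
    ≡⟨ solve 3 (λ s f i → s :* (f :* i) := f :* (s :* i)) refl s (ι (n !)) (inv (π₂ bs)) ⟩
  ι (n !) * (s * inv (π₂ bs))
    ≡⟨ cong (λ k → ι (n !) * (s * inv k)) (sym (π₂From-zero bs)) ⟩
  ι (n !) * weight 0 (length α) bs
    ∎
  where
    open ≡-Reasoning
    s = sign (length α ℕ.∸ length bs)

lemma2p5 : (n : ℕ) (α : List ℕ) → IsComposition n α →
    frac (n !) (π (reverse α)) ≡ sumℚ (map (term n α) (blockings α))
lemma2p5 .(sum α) α (parts>0 , refl) = begin
  frac (n !) (π (reverse α))                                          ≡⟨ cong (frac (n !)) (π-reverse α) ⟩
  frac (n !) (πrev α)                                                 ≡⟨ frac≡ι*inv (n !) (πrev α) ⟩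
  ι (n !) * inv (πrev α)                                              ≡⟨ cong (ι (n !) *_) (sym (weightSum-zero parts>0)) ⟩
  ι (n !) * weightSum 0 α                                             ≡⟨ sym (sumℚ-map-*ˡ (ι (n !)) (weight 0 (length α)) (blockings α)) ⟩
  sumℚ (map (λ bs → ι (n !) * weight 0 (length α) bs) (blockings α))  ≡⟨ cong sumℚ (map-cong (sym ∘ term≡ι!*weight n α) (blockings α)) ⟩
  sumℚ (map (term n α) (blockings α))                                 ∎
  where
    open ≡-Reasoning
    n = sum α
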